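{- Let $n \geq 1$ and let $z = \sum_{i=2}^{n+1} x_{1,i} \in \mathrm{VG}_n$. Then $z^d \neq 0$ for all $0 \leq d \leq n$.
   Context: $\mathrm{VG}_n$ is the commutative $\mathbb{Q}$-algebra \[\mathrm{VG}_n = \mathbb{Q}[x_{ij} : 1 \leq i \neq j \leq n+1]\big/\langle x_{ij}^2,\; x_{ij}+x_{ji},\; x_{ij}x_{jk}+x_{jk}x_{ki}+x_{ki}x_{ij}\rangle,\] with relations over all distinct $i,j,k \in \{1,\dots,n+1\}$. -}

module Defs where

open import Data.Nat using (ℕ; zero; suc)
open import Data.Fin using (Fin; zero; suc)
open import Data.Rational using (ℚ; 0ℚ; 1ℚ) renaming (_+_ to _+ℚ_; _*_ to _*ℚ_; -_ to -ℚ_)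
open import Relation.Binary.PropositionalEquality using (_≡_; _≢_; sym)

-- Terms of the free commutative ℚ-algebra on generators x_ij (i ≠ j),
-- indices i, j ∈ {1,…,n+1} represented by Fin (suc n) (so index 1 is `zero`).
infixl 6 _⊕_
infixl 7 _⊗_

data Term (n : ℕ) : Set where
  const : ℚ → Term n
  var   : (i j : Fin (suc n)) → .(i ≢ j) → Term n
  _⊕_   : Term n → Term n → Term n
  _⊗_   : Term n → Term n → Term n

≢-flip : ∀ {n} {i j : Fin n} → i ≢ j → j ≢ i
≢-flip ij eq = ij (sym eq)

-- Term n / ≈ is exactly
-- ℚ[x_ij] / ⟨x_ij², x_ij + x_ji, x_ij x_jk + x_jk x_ki + x_ki x_ij⟩.
infix 4 _≈_

data _≈_ {n : ℕ} : Term n → Term n → Set where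
  ≈-refl  : ∀ {a} → a ≈ a
  ≈-sym   : ∀ {a b} → a ≈ b → b ≈ a
  ≈-trans : ∀ {a b c} → a ≈ b → b ≈ c → a ≈ c
  ⊕-cong  : ∀ {a b c d} → a ≈ b → c ≈ d → a ⊕ c ≈ b ⊕ d
  ⊗-cong  : ∀ {a b c d} → a ≈ b → c ≈ d → a ⊗ c ≈ b ⊗ d
  ⊕-assoc : ∀ a b c → (a ⊕ b) ⊕ c ≈ a ⊕ (b ⊕ c)
  ⊕-comm  : ∀ a b → a ⊕ b ≈ b ⊕ a
  ⊕-idˡ   : ∀ a → const 0ℚ ⊕ a ≈ a
  ⊕-invˡ  : ∀ a → const (-ℚ 1ℚ) ⊗ a ⊕ a ≈ const 0ℚ
  ⊗-assoc : ∀ a b c → (a ⊗ b) ⊗ c ≈ a ⊗ (b ⊗ c)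
  ⊗-comm  : ∀ a b → a ⊗ b ≈ b ⊗ a
  ⊗-idˡ   : ∀ a → const 1ℚ ⊗ a ≈ a
  distribˡ : ∀ a b c → a ⊗ (b ⊕ c) ≈ a ⊗ b ⊕ a ⊗ c
  const-+ : ∀ p q → const (p +ℚ q) ≈ const p ⊕ const q
  const-* : ∀ p q → const (p *ℚ q) ≈ const p ⊗ const q
  rel-sq   : ∀ i j (ij : i ≢ j) → var i j ij ⊗ var i j ij ≈ const 0ℚ
  rel-anti : ∀ i j (ij : i ≢ j) → var i j ij ⊕ var j i (≢-flip ij) ≈ const 0ℚ
  rel-tri  : ∀ i j k (ij : i ≢ j) (jk : j ≢ k) (ki : k ≢ i) →
             var i j ij ⊗ var j k jk ⊕ var j k jk ⊗ var k i ki ⊕ var k i ki ⊗ var i j ij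
               ≈ const 0ℚ

sumFin : ∀ {n} (m : ℕ) → (Fin m → Term n) → Term n
sumFin zero    f = const 0ℚ
sumFin (suc m) f = f zero ⊕ sumFin m (λ k → f (suc k))

0≢suc : ∀ {n} {k : Fin n} → zero ≢ suc k
0≢suc ()

z : (n : ℕ) → Term n
z n = sumFin n (λ k → var zero (suc k) 0≢suc)

_^_ : ∀ {n} → Term n → ℕ → Term n
a ^ zero  = const 1ℚ
a ^ suc d = a ⊗ (a ^ d)

{-# OPTIONS --safe #-}
module Submission where

-- Map VG_n to ℚ[ε₁,…,εₙ]/(ε₁²,…,εₙ²), built as iterated dual numbers, by sending x_ij
-- to e_j if i < j and to −e_i otherwise, where e₁ = 0 and e_{i+1} = ε_i. Every x_ij is
-- then ± the generator of the larger index, so squares vanish, x_ij + x_ji = 0, and in a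
-- triangle relation the two terms containing ±e_m (m the largest index) cancel while the
-- third is ±e_m² = 0. The map sends z to ε₁ + ⋯ + εₙ, whose n-th power is n! ε₁⋯εₙ ≠ 0;
-- so z^n ≠ 0, hence z^d ≠ 0 for d ≤ n.

open import Level using (_⊔_; 0ℓ)
open import Function using (id; _∘_)
open import Data.Nat as ℕ using (ℕ; zero; suc; _≤_; _∸_; z≤n; s≤s)
open import Data.Nat.Properties using (m+[n∸m]≡n; ≮⇒≥)
open import Data.Fin using (Fin; zero; suc; _<_; _<?_)
open import Data.Fin.Properties using (<-asym; <-trans; ≤-antisym; ≤-trans)
open import Data.Product using (_,_; proj₂)
open import Data.Vec.Functional using (Vector; _∷_)
open import Relation.Nullary using (¬_; yes; no; contradiction)
open import Relation.Binary.PropositionalEquality as ≡ using (_≡_; _≢_)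
open import Algebra.Bundles using (Monoid; AbelianGroup; Semiring; CommutativeRing)
open import Algebra.Morphism.Structures using (IsMonoidHomomorphism; IsRingHomomorphism)
import Algebra.Construct.DirectProduct as DirectProduct
import Algebra.Morphism.Construct.Composition as Composition
import Algebra.Morphism.Construct.Identity as Identity
open import Data.Rational using (0ℚ)
import Data.Rational as ℚ
import Data.Rational.Properties as ℚ

module _ {c ℓ} (S : Semiring c ℓ) where
  open Semiring S
  open import Algebra.Properties.Semiring.Exp S using (_^_; ^-homo-*)

  x^m≈0⇒x^n≈0 : ∀ {x m n} → m ≤ n → x ^ m ≈ 0# → x ^ n ≈ 0#
  x^m≈0⇒x^n≈0 {x} {m} {n} m≤n x^m≈0 = begin
    x ^ n               ≡⟨ ≡.cong (x ^_) (m+[n∸m]≡n m≤n) ⟨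
    x ^ (m ℕ.+ (n ∸ m)) ≈⟨ ^-homo-* x m (n ∸ m) ⟩
    x ^ m * x ^ (n ∸ m) ≈⟨ *-congʳ x^m≈0 ⟩
    0# * x ^ (n ∸ m)    ≈⟨ zeroˡ _ ⟩
    0#                  ∎
    where open import Relation.Binary.Reasoning.Setoid setoid

module MonoidHomomorphismProperties
  {a b ℓa ℓb} (M : Monoid a ℓa) (N : Monoid b ℓb) {f : Monoid.Carrier M → Monoid.Carrier N}
  (f-isMonoidHomomorphism : IsMonoidHomomorphism (Monoid.rawMonoid M) (Monoid.rawMonoid N) f)
  where

  private
    module M = Monoid M
    module N = Monoid N
  open IsMonoidHomomorphism f-isMonoidHomomorphism
  open import Algebra.Definitions.RawMonoid M.rawMonoid using () renaming (_×_ to _×ᴹ_; sum to sumᴹ)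
  open import Algebra.Definitions.RawMonoid N.rawMonoid using () renaming (_×_ to _×ᴺ_; sum to sumᴺ)

  ×-homo : ∀ m x → f (m ×ᴹ x) N.≈ m ×ᴺ f x
  ×-homo zero    x = ε-homo
  ×-homo (suc m) x = N.trans (homo x (m ×ᴹ x)) (N.∙-congˡ (×-homo m x))

  sum-homo : ∀ {m} (xs : Vector M.Carrier m) → f (sumᴹ xs) N.≈ sumᴺ (f ∘ xs)
  sum-homo {zero}  xs = ε-homo
  sum-homo {suc m} xs = N.trans (homo (xs zero) (sumᴹ (xs ∘ suc))) (N.∙-congˡ (sum-homo (xs ∘ suc)))

module DualNumbers {c ℓ} (R : CommutativeRing c ℓ) where
  open CommutativeRing R
  open import Algebra.Properties.Semiring.Exp semiring using (_^_)
  open import Algebra.Properties.Semiring.Mult semiring using (_×_; ×-comm-*)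
  open import Algebra.Properties.CommutativeSemigroup +-commutativeSemigroup using (interchange)
  open import Relation.Binary.Reasoning.Setoid setoid

  private
    module R² = AbelianGroup (DirectProduct.abelianGroup +-abelianGroup +-abelianGroup)
  open import Algebra.Consequences.Setoid R².setoid using (comm∧idˡ⇒id; comm∧distrˡ⇒distr)
  -- (a , b) stands for a + bε, where ε² = 0.
  infixl 7 _*ᴰ_
  _*ᴰ_ : R².Carrier → R².Carrier → R².Carrier
  (a , b) *ᴰ (c , d) = a * c , a * d + b * c

  private
    *ᴰ-cong : ∀ {x x′ y y′} → x R².≈ x′ → y R².≈ y′ → x *ᴰ y R².≈ x′ *ᴰ y′
    *ᴰ-cong (a≈a′ , b≈b′) (c≈c′ , d≈d′) =
      *-cong a≈a′ c≈c′ , +-cong (*-cong a≈a′ d≈d′) (*-cong b≈b′ c≈c′)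

    *ᴰ-assoc : ∀ x y w → (x *ᴰ y) *ᴰ w R².≈ x *ᴰ (y *ᴰ w)
    *ᴰ-assoc (a , b) (c , d) (e , f) = *-assoc a c e , (begin
      a * c * f + (a * d + b * c) * e         ≈⟨ +-congˡ (distribʳ e (a * d) (b * c)) ⟩
      a * c * f + (a * d * e + b * c * e)     ≈⟨ +-assoc _ _ _ ⟨
      a * c * f + a * d * e + b * c * e
        ≈⟨ +-cong (+-cong (*-assoc a c f) (*-assoc a d e)) (*-assoc b c e) ⟩
      a * (c * f) + a * (d * e) + b * (c * e) ≈⟨ +-congʳ (distribˡ a (c * f) (d * e)) ⟨
      a * (c * f + d * e) + b * (c * e)       ∎)

    *ᴰ-identityˡ : ∀ x → (1# , 0#) *ᴰ x R².≈ x
    *ᴰ-identityˡ (a , b) =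
      *-identityˡ a , trans (+-cong (*-identityˡ b) (zeroˡ a)) (+-identityʳ b)

    *ᴰ-distribˡ : ∀ x y w → x *ᴰ (y R².∙ w) R².≈ (x *ᴰ y) R².∙ (x *ᴰ w)
    *ᴰ-distribˡ (a , b) (c , d) (e , f) = distribˡ a c e ,
      trans (+-cong (distribˡ a d f) (distribˡ b c e)) (interchange (a * d) (a * f) (b * c) (b * e))

    *ᴰ-comm : ∀ x y → x *ᴰ y R².≈ y *ᴰ x
    *ᴰ-comm (a , b) (c , d) = *-comm a c , trans (+-comm _ _) (+-cong (*-comm b c) (*-comm a d))

  dualNumbers : CommutativeRing c ℓ
  dualNumbers = record
    { Carrier = R².Carrier
    ; _≈_ = R²._≈_
    ; _+_ = R²._∙_
    ; _*_ = _*ᴰ_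
    ; -_ = R²._⁻¹
    ; 0# = R².ε
    ; 1# = 1# , 0#
    ; isCommutativeRing = record
      { isRing = record
        { +-isAbelianGroup = R².isAbelianGroup
        ; *-cong = *ᴰ-cong
        ; *-assoc = *ᴰ-assoc
        ; *-identity = comm∧idˡ⇒id *ᴰ-comm *ᴰ-identityˡ
        ; distrib = comm∧distrˡ⇒distr R².∙-cong *ᴰ-comm *ᴰ-distribˡ
        }
      ; *-comm = *ᴰ-comm
      }
    }

  private
    module D = CommutativeRing dualNumbers
  open import Algebra.Properties.Ring ring using (-0#≈0#)
  open import Algebra.Definitions.RawMonoid +-rawMonoid using (sum)
  open import Algebra.Definitions.RawMonoid D.+-rawMonoid using () renaming (sum to sumᴰ)
  open import Algebra.Properties.Semiring.Exp D.semiring using () renaming (_^_ to _^ᴰ_)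

  embed : Carrier → D.Carrier
  embed a = a , 0#

  ε : D.Carrier
  ε = 0# , 1#

  embed-isRingHomomorphism : IsRingHomomorphism rawRing D.rawRing embed
  embed-isRingHomomorphism = record
    { isSemiringHomomorphism = record
      { isNearSemiringHomomorphism = record
        { +-isMonoidHomomorphism = record
          { isMagmaHomomorphism = record
            { isRelHomomorphism = record { cong = λ a≈b → a≈b , refl }
            ; homo = λ a b → refl , sym (+-identityʳ 0#)
            }
          ; ε-homo = D.refl
          }
        ; *-homo = λ a b → refl , sym (trans (+-cong (zeroʳ a) (zeroˡ b)) (+-identityʳ 0#))
        }
      ; 1#-homo = D.refl
      }
    ; -‿homo = λ a → refl , sym -0#≈0#
    }

  dualPart-isMonoidHomomorphism : IsMonoidHomomorphism D.+-rawMonoid +-rawMonoid proj₂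
  dualPart-isMonoidHomomorphism = record
    { isMagmaHomomorphism = record
      { isRelHomomorphism = record { cong = proj₂ }
      ; homo = λ _ _ → refl
      }
    ; ε-homo = refl
    }

  ε*ε≈0 : ε D.* ε D.≈ D.0#
  ε*ε≈0 = zeroˡ 0# , trans (+-cong (zeroˡ 1#) (zeroʳ 1#)) (+-identityʳ 0#)

  ε+embed[a]≈a+ε : ∀ a → ε D.+ embed a D.≈ (a , 1#)
  ε+embed[a]≈a+ε a = +-identityˡ a , +-identityʳ 1#

  [a+ε]^[1+m] : ∀ a m → (a , 1#) ^ᴰ suc m D.≈ (a ^ suc m , suc m × a ^ m)
  [a+ε]^[1+m] a zero    = refl , trans (+-cong (zeroʳ a) (*-identityˡ 1#)) (+-comm 0# 1#)
  [a+ε]^[1+m] a (suc m) = D.trans (D.*-congˡ ([a+ε]^[1+m] a m)) (refl , (begin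
    a * (suc m × a ^ m) + 1# * a ^ suc m  ≈⟨ +-cong (×-comm-* (suc m) a (a ^ m)) (*-identityˡ _) ⟩
    suc m × a ^ suc m + a ^ suc m          ≈⟨ +-comm _ _ ⟩
    suc (suc m) × a ^ suc m                ∎))

module _ {c ℓ} (R : CommutativeRing c ℓ) where
  open CommutativeRing R
  open import Algebra.Properties.Ring ring using (-0#≈0#; -‿distribˡ-*; -‿distribʳ-*)
  open import Relation.Binary.Reasoning.Setoid setoid

  record SatisfiesVGRelations {n} (x : Fin (suc n) → Fin (suc n) → Carrier) : Set (c ⊔ ℓ) where
    field
      square        : ∀ {i j} → i ≢ j → x i j * x i j ≈ 0#
      antisymmetric : ∀ {i j} → i ≢ j → x i j + x j i ≈ 0#
      triangle      : ∀ {i j k} → i ≢ j → j ≢ k → k ≢ i →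
                      x i j * x j k + x j k * x k i + x k i * x i j ≈ 0#

  u*u≈0⇒u*-u≈0 : ∀ {u} → u * u ≈ 0# → u * - u ≈ 0#
  u*u≈0⇒u*-u≈0 {u} u*u≈0 = trans (sym (-‿distribʳ-* u u)) (trans (-‿cong u*u≈0) -0#≈0#)

  u*u≈0⇒-u*-u≈0 : ∀ {u} → u * u ≈ 0# → - u * - u ≈ 0#
  u*u≈0⇒-u*-u≈0 {u} u*u≈0 =
    trans (sym (-‿distribˡ-* u (- u))) (trans (-‿cong (u*u≈0⇒u*-u≈0 u*u≈0)) -0#≈0#)

  cyclicSum : Carrier → Carrier → Carrier → Carrier
  cyclicSum u v w = u * v + v * w + w * u

  cyclicSum-rotate : ∀ u v w → cyclicSum u v w ≈ cyclicSum v w u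
  cyclicSum-rotate u v w = begin
    u * v + v * w + w * u   ≈⟨ +-congʳ (+-comm _ _) ⟩
    v * w + u * v + w * u   ≈⟨ +-assoc _ _ _ ⟩
    v * w + (u * v + w * u) ≈⟨ +-congˡ (+-comm _ _) ⟩
    v * w + (w * u + u * v) ≈⟨ +-assoc _ _ _ ⟨
    v * w + w * u + u * v   ∎

  cyclicSum[u,-u,w]≈0 : ∀ {u} w → u * u ≈ 0# → cyclicSum u (- u) w ≈ 0#
  cyclicSum[u,-u,w]≈0 {u} w u*u≈0 = begin
    u * - u + - u * w + w * u   ≈⟨ +-assoc _ _ _ ⟩
    u * - u + (- u * w + w * u)
      ≈⟨ +-cong (u*u≈0⇒u*-u≈0 u*u≈0) (+-cong (sym (-‿distribˡ-* u w)) (*-comm w u)) ⟩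
    0# + (- (u * w) + u * w)    ≈⟨ +-identityˡ _ ⟩
    - (u * w) + u * w           ≈⟨ -‿inverseˡ _ ⟩
    0#                          ∎

  cyclicSum[w,u,-u]≈0 : ∀ {u} w → u * u ≈ 0# → cyclicSum w u (- u) ≈ 0#
  cyclicSum[w,u,-u]≈0 {u} w u*u≈0 = trans (cyclicSum-rotate w u (- u)) (cyclicSum[u,-u,w]≈0 w u*u≈0)

  cyclicSum[-u,w,u]≈0 : ∀ {u} w → u * u ≈ 0# → cyclicSum (- u) w u ≈ 0#
  cyclicSum[-u,w,u]≈0 {u} w u*u≈0 = trans (cyclicSum-rotate (- u) w u) (cyclicSum[w,u,-u]≈0 w u*u≈0)

  maxAssignment : ∀ {n} → Vector Carrier (suc n) → Fin (suc n) → Fin (suc n) → Carrier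
  maxAssignment e i j with i <? j
  ... | yes _ = e j
  ... | no  _ = - e i

  module _ {n} {e : Vector Carrier (suc n)} where

    maxAssignment-< : ∀ {i j} → i < j → maxAssignment e i j ≡ e j
    maxAssignment-< {i} {j} i<j with i <? j
    ... | yes _   = ≡.refl
    ... | no  i≮j = contradiction i<j i≮j

    module _ (e*e≈0 : ∀ i → e i * e i ≈ 0#) where

      maxAssignment-square : ∀ i j → maxAssignment e i j * maxAssignment e i j ≈ 0#
      maxAssignment-square i j with i <? j
      ... | yes _ = e*e≈0 j
      ... | no  _ = u*u≈0⇒-u*-u≈0 (e*e≈0 i)

      maxAssignment-antisymmetric : ∀ {i j} → i ≢ j → maxAssignment e i j + maxAssignment e j i ≈ 0#
      maxAssignment-antisymmetric {i} {j} i≢j with i <? j | j <? i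
      ... | yes i<j | yes j<i = contradiction j<i (<-asym i<j)
      ... | yes _   | no  _   = -‿inverseʳ (e j)
      ... | no  _   | yes _   = -‿inverseˡ (e i)
      ... | no  i≮j | no  j≮i = contradiction (≤-antisym (≮⇒≥ j≮i) (≮⇒≥ i≮j)) i≢j

      maxAssignment-triangle : ∀ {i j k} → i ≢ j →
        cyclicSum (maxAssignment e i j) (maxAssignment e j k) (maxAssignment e k i) ≈ 0#
      maxAssignment-triangle {i} {j} {k} i≢j with i <? j | j <? k | k <? i
      ... | yes i<j | yes j<k | yes k<i = contradiction k<i (<-asym (<-trans i<j j<k))
      ... | yes _   | yes _   | no  _   = cyclicSum[w,u,-u]≈0 (e j) (e*e≈0 k)
      ... | yes _   | no  _   | yes _   = cyclicSum[u,-u,w]≈0 (e i) (e*e≈0 j)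
      ... | yes _   | no  _   | no  _   = cyclicSum[u,-u,w]≈0 (- e k) (e*e≈0 j)
      ... | no  _   | yes _   | yes _   = cyclicSum[-u,w,u]≈0 (e k) (e*e≈0 i)
      ... | no  _   | yes _   | no  _   = cyclicSum[w,u,-u]≈0 (- e i) (e*e≈0 k)
      ... | no  _   | no  _   | yes _   = cyclicSum[-u,w,u]≈0 (- e j) (e*e≈0 i)
      ... | no  i≮j | no  j≮k | no  k≮i =
        contradiction (≤-antisym (≤-trans (≮⇒≥ k≮i) (≮⇒≥ j≮k)) (≮⇒≥ i≮j)) i≢j

      maxAssignment-satisfiesVGRelations : SatisfiesVGRelations (maxAssignment e)
      maxAssignment-satisfiesVGRelations = record
        { square        = λ {i} {j} _ → maxAssignment-square i j
        ; antisymmetric = maxAssignment-antisymmetric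
        ; triangle      = λ i≢j _ _ → maxAssignment-triangle i≢j
        }

-- tower k = ℚ[ε₁,…,ε_k]/(ε₁²,…,ε_k²)
tower : ℕ → CommutativeRing 0ℓ 0ℓ
tower zero    = ℚ.+-*-commutativeRing
tower (suc k) = DualNumbers.dualNumbers (tower k)

module Tower (k : ℕ) where
  open CommutativeRing (tower k) public hiding (zero)
  open import Algebra.Properties.Semiring.Exp semiring public using (_^_; ^-congˡ)
  open import Algebra.Definitions.RawMonoid +-rawMonoid public using (sum)

open import Algebra.Definitions.RawMonoid ℚ.+-0-rawMonoid using () renaming (_×_ to _×ℚ_)

ι : ∀ k → ℚ.ℚ → Tower.Carrier k
ι zero    = id
ι (suc k) = DualNumbers.embed (tower k) ∘ ι k

ι-isRingHomomorphism : ∀ k → IsRingHomomorphism ℚ.+-*-rawRing (Tower.rawRing k) (ι k)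
ι-isRingHomomorphism zero    = Identity.isRingHomomorphism ℚ.+-*-rawRing ≡.refl
ι-isRingHomomorphism (suc k) = Composition.isRingHomomorphism (Tower.trans (suc k))
  (ι-isRingHomomorphism k) (DualNumbers.embed-isRingHomomorphism (tower k))

ε : ∀ k → Vector (Tower.Carrier k) k
ε (suc k) zero    = DualNumbers.ε (tower k)
ε (suc k) (suc i) = DualNumbers.embed (tower k) (ε k i)

ε*ε≈0 : ∀ k i → let open Tower k in ε k i * ε k i ≈ 0#
ε*ε≈0 (suc k) zero    = DualNumbers.ε*ε≈0 (tower k)
ε*ε≈0 (suc k) (suc i) = trans (sym (*-homo (ε k i) (ε k i))) (trans (⟦⟧-cong (ε*ε≈0 k i)) 0#-homo)
  where
  open Tower (suc k)
  open IsRingHomomorphism (DualNumbers.embed-isRingHomomorphism (tower k))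

Σε : ∀ k → Tower.Carrier k
Σε k = Tower.sum k (ε k)

Σε-suc : ∀ k → let open Tower (suc k) in Σε (suc k) ≈ (Σε k , Tower.1# k)
Σε-suc k = trans (+-congˡ (sym (sum-homo (ε k)))) (DualNumbers.ε+embed[a]≈a+ε (tower k) (Σε k))
  where
  open Tower (suc k)
  open IsRingHomomorphism (DualNumbers.embed-isRingHomomorphism (tower k))
  open MonoidHomomorphismProperties (Tower.+-monoid k) +-monoid +-isMonoidHomomorphism

-- The coefficient of ε₁⋯ε_k.
topCoefficient : ∀ k → Tower.Carrier k → ℚ.ℚ
topCoefficient zero    = id
topCoefficient (suc k) = topCoefficient k ∘ proj₂

topCoefficient-isMonoidHomomorphism : ∀ k →
  IsMonoidHomomorphism (Tower.+-rawMonoid k) ℚ.+-0-rawMonoid (topCoefficient k)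
topCoefficient-isMonoidHomomorphism zero    = Identity.isMonoidHomomorphism ℚ.+-0-rawMonoid ≡.refl
topCoefficient-isMonoidHomomorphism (suc k) = Composition.isMonoidHomomorphism ≡.trans
  (DualNumbers.dualPart-isMonoidHomomorphism (tower k)) (topCoefficient-isMonoidHomomorphism k)

module _ (k : ℕ) where
  private
    module R = Tower k
    module D = Tower (suc k)
  open IsMonoidHomomorphism (topCoefficient-isMonoidHomomorphism (suc k)) using (⟦⟧-cong)
  open MonoidHomomorphismProperties R.+-monoid ℚ.+-0-monoid (topCoefficient-isMonoidHomomorphism k)

  topCoefficient[Σε^k]-suc :
    topCoefficient (suc k) (Σε (suc k) D.^ suc k) ≡ suc k ×ℚ topCoefficient k (Σε k R.^ k)
  topCoefficient[Σε^k]-suc = ≡.trans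
    (⟦⟧-cong (D.trans (D.^-congˡ (suc k) (Σε-suc k)) (DualNumbers.[a+ε]^[1+m] (tower k) (Σε k) k)))
    (×-homo (suc k) (Σε k R.^ k))

×ℚ-positive : ∀ m q → .{{ℚ.Positive q}} → ℚ.Positive (suc m ×ℚ q)
×ℚ-positive zero    q = ℚ.pos+nonNeg⇒pos q 0ℚ
×ℚ-positive (suc m) q = ℚ.pos+pos⇒pos q (suc m ×ℚ q) {{×ℚ-positive m q}}

topCoefficient[Σε^k]-positive : ∀ k → let open Tower k in ℚ.Positive (topCoefficient k (Σε k ^ k))
topCoefficient[Σε^k]-positive zero    = _
topCoefficient[Σε^k]-positive (suc k) = ≡.subst ℚ.Positive (≡.sym (topCoefficient[Σε^k]-suc k))
  (×ℚ-positive k (topCoefficient k (Σε k ^ k)) {{topCoefficient[Σε^k]-positive k}})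
  where open Tower k using (_^_)

Σε^d≉0 : ∀ n {d} → d ≤ n → let open Tower n in ¬ (Σε n ^ d ≈ 0#)
Σε^d≉0 n d≤n Σε^d≈0 =
  ℚ.<-irrefl (≡.sym topCoefficient[Σε^n]≡0) (ℚ.positive⁻¹ _ {{topCoefficient[Σε^k]-positive n}})
  where
  open Tower n
  open IsMonoidHomomorphism (topCoefficient-isMonoidHomomorphism n)
  topCoefficient[Σε^n]≡0 : topCoefficient n (Σε n ^ n) ≡ 0ℚ
  topCoefficient[Σε^n]≡0 = ≡.trans (⟦⟧-cong (x^m≈0⇒x^n≈0 semiring d≤n Σε^d≈0)) ε-homo

open import Defs

module Interpretation {c ℓ} (R : CommutativeRing c ℓ) {φ : ℚ.ℚ → CommutativeRing.Carrier R}
  (φ-isRingHomomorphism : IsRingHomomorphism ℚ.+-*-rawRing (CommutativeRing.rawRing R) φ)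
  {n : ℕ} (x : Fin (suc n) → Fin (suc n) → CommutativeRing.Carrier R)
  where

  private
    module R = CommutativeRing R
  open IsRingHomomorphism φ-isRingHomomorphism using (+-homo; *-homo; 0#-homo; 1#-homo; -‿homo)
  open import Algebra.Properties.Ring R.ring using (-1*x≈-x)
  open import Algebra.Properties.Semiring.Exp R.semiring using () renaming (_^_ to _^ᴿ_)
  open import Algebra.Definitions.RawMonoid R.+-rawMonoid using (sum)

  ⟦_⟧ : Term n → R.Carrier
  ⟦ const q ⟧   = φ q
  ⟦ var i j _ ⟧ = x i j
  ⟦ a ⊕ b ⟧     = ⟦ a ⟧ R.+ ⟦ b ⟧
  ⟦ a ⊗ b ⟧     = ⟦ a ⟧ R.* ⟦ b ⟧

  ⟦sumFin⟧ : ∀ m (f : Fin m → Term n) → ⟦ sumFin m f ⟧ R.≈ sum (⟦_⟧ ∘ f)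
  ⟦sumFin⟧ zero    f = 0#-homo
  ⟦sumFin⟧ (suc m) f = R.+-congˡ (⟦sumFin⟧ m (f ∘ suc))

  ⟦^⟧ : ∀ a d → ⟦ a ^ d ⟧ R.≈ ⟦ a ⟧ ^ᴿ d
  ⟦^⟧ a zero    = 1#-homo
  ⟦^⟧ a (suc d) = R.*-congˡ (⟦^⟧ a d)

  module _ (relations : SatisfiesVGRelations R x) where
    open SatisfiesVGRelations relations

    ⟦⟧-cong : ∀ {a b} → a ≈ b → ⟦ a ⟧ R.≈ ⟦ b ⟧
    ⟦⟧-cong ≈-refl                   = R.refl
    ⟦⟧-cong (≈-sym p)                = R.sym (⟦⟧-cong p)
    ⟦⟧-cong (≈-trans p q)            = R.trans (⟦⟧-cong p) (⟦⟧-cong q)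
    ⟦⟧-cong (⊕-cong p q)             = R.+-cong (⟦⟧-cong p) (⟦⟧-cong q)
    ⟦⟧-cong (⊗-cong p q)             = R.*-cong (⟦⟧-cong p) (⟦⟧-cong q)
    ⟦⟧-cong (⊕-assoc a b c)          = R.+-assoc ⟦ a ⟧ ⟦ b ⟧ ⟦ c ⟧
    ⟦⟧-cong (⊕-comm a b)             = R.+-comm ⟦ a ⟧ ⟦ b ⟧
    ⟦⟧-cong (⊕-idˡ a)                = R.trans (R.+-congʳ 0#-homo) (R.+-identityˡ ⟦ a ⟧)
    ⟦⟧-cong (⊕-invˡ a)               =
      R.trans (R.+-congʳ φ[-1]*a≈-a) (R.trans (R.-‿inverseˡ ⟦ a ⟧) (R.sym 0#-homo))
      where
      φ[-1]*a≈-a : φ (ℚ.- ℚ.1ℚ) R.* ⟦ a ⟧ R.≈ R.- ⟦ a ⟧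
      φ[-1]*a≈-a = R.trans (R.*-congʳ (R.trans (-‿homo ℚ.1ℚ) (R.-‿cong 1#-homo))) (-1*x≈-x ⟦ a ⟧)
    ⟦⟧-cong (⊗-assoc a b c)          = R.*-assoc ⟦ a ⟧ ⟦ b ⟧ ⟦ c ⟧
    ⟦⟧-cong (⊗-comm a b)             = R.*-comm ⟦ a ⟧ ⟦ b ⟧
    ⟦⟧-cong (⊗-idˡ a)                = R.trans (R.*-congʳ 1#-homo) (R.*-identityˡ ⟦ a ⟧)
    ⟦⟧-cong (distribˡ a b c)         = R.distribˡ ⟦ a ⟧ ⟦ b ⟧ ⟦ c ⟧
    ⟦⟧-cong (const-+ p q)            = +-homo p q
    ⟦⟧-cong (const-* p q)            = *-homo p q
    ⟦⟧-cong (rel-sq i j ij)          = R.trans (square ij) (R.sym 0#-homo)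
    ⟦⟧-cong (rel-anti i j ij)        = R.trans (antisymmetric ij) (R.sym 0#-homo)
    ⟦⟧-cong (rel-tri i j k ij jk ki) = R.trans (triangle ij jk ki) (R.sym 0#-homo)

module _ (n : ℕ) where
  private
    module T = Tower n
  open import Algebra.Properties.Monoid.Sum T.+-monoid using (sum-cong-≗)
  open import Relation.Binary.Reasoning.Setoid T.setoid
  open IsRingHomomorphism (ι-isRingHomomorphism n) using (0#-homo)

  private
    e : Vector T.Carrier (suc n)
    e = T.0# ∷ ε n

    e*e≈0 : ∀ i → e i T.* e i T.≈ T.0#
    e*e≈0 zero    = T.zeroˡ T.0#
    e*e≈0 (suc i) = ε*ε≈0 n i

  open Interpretation (tower n) (ι-isRingHomomorphism n) (maxAssignment (tower n) e)

  ⟦z⟧≈Σε : ⟦ z n ⟧ T.≈ Σε n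
  ⟦z⟧≈Σε = T.trans (⟦sumFin⟧ n _) (T.reflexive (sum-cong-≗ x₁,₁₊ᵢ≡εᵢ))
    where
    x₁,₁₊ᵢ≡εᵢ : ∀ i → maxAssignment (tower n) e zero (suc i) ≡ ε n i
    x₁,₁₊ᵢ≡εᵢ i = maxAssignment-< (tower n) {e = e} (s≤s z≤n)

  z^d≈0⇒Σε^d≈0 : ∀ {d} → z n ^ d ≈ const 0ℚ → Σε n T.^ d T.≈ T.0#
  z^d≈0⇒Σε^d≈0 {d} z^d≈0 = begin
    Σε n T.^ d      ≈⟨ T.^-congˡ d ⟦z⟧≈Σε ⟨
    ⟦ z n ⟧ T.^ d   ≈⟨ ⟦^⟧ (z n) d ⟨
    ⟦ z n ^ d ⟧     ≈⟨ ⟦⟧-cong (maxAssignment-satisfiesVGRelations (tower n) e*e≈0) z^d≈0 ⟩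
    ⟦ const 0ℚ ⟧    ≈⟨ 0#-homo ⟩
    T.0#            ∎

lemma3p1 : (n : ℕ) → 1 ≤ n → (d : ℕ) → d ≤ n → ¬ ((z n) ^ d ≈ const 0ℚ)
lemma3p1 n _ d d≤n = Σε^d≉0 n d≤n ∘ z^d≈0⇒Σε^d≈0 n
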